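{- Let $m\ge0$ be even. Among the self twin parsimonious games with $m+4$ players whose free type representation has an odd number of components, for each $c=1,\dots,m/2$ exactly $2^{m/2-c}$ games have pivot $2c-1$, and exactly one game has pivot $m+3$.
   Context: Parsimonious (P) games: constant-sum homogeneous weighted majority games on $n$ players, without dummies and without dictator, having exactly $n$ minimal winning coalitions (homogeneous: weights $\mathbf w$, quota $q$, $S$ winning iff $\sum_{i\in S}w_i\ge q$, with equality for every minimal winning $S$). Each has a unique minimal homogeneous representation with integer weights $1=w_1\le\dots\le w_n$. Binary representation: $\mathbf b\in\{0,1\}^n$, $b_1=1$, $b_i=1$ iff $w_i>w_{i-1}$. Known: $b_1=1,b_2=0,b_{n-1}=0,b_n=1$ always, and $(b_3,\dots,b_{n-2})$ determines the game, every vector in $\{0,1\}^{n-4}$ arising. The number of types $h$ is the number of distinct weights; the type representation is $(x_1,\dots,x_h)$, $x_t$ the number of players with the $t$-th smallest distinct weight; the free type representation is $(x_1,\dots,x_{h-1})$. A P game is self twin if $b_i=b_{n+1-i}$ for $i=3,\dots,n-2$. When $h-1$ is odd, the middle component $x_{h/2}$ is called the pivot. -}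

module Defs where

open import Data.Bool using (Bool; true; false; _∧_; not)
open import Data.Nat using (ℕ; zero; suc; _+_; _*_; _∸_; _≡ᵇ_; _/_)
open import Data.List using (List; []; _∷_; _++_; length)
open import Data.Vec using (Vec; toList; reverse)
import Data.Vec as V
open import Data.Maybe using (Maybe; just; nothing)

-- A parsimonious (P) game on n = m + 4 players is identified (bijectively,
-- as recalled in the paper) with its free bits (b_3,...,b_{n-2}) : Vec Bool m.
PGame : ℕ → Set
PGame m = Vec Bool m

allVecs : (m : ℕ) → List (Vec Bool m)
allVecs zero = V.[] ∷ []
allVecs (suc m) = mapCons true (allVecs m) ++ mapCons false (allVecs m)
  where
  mapCons : Bool → List (Vec Bool m) → List (Vec Bool (suc m))
  mapCons b [] = []
  mapCons b (v ∷ vs) = (b V.∷ v) ∷ mapCons b vs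

count : {A : Set} → (A → Bool) → List A → ℕ
count p [] = 0
count p (x ∷ xs) with p x
... | true = suc (count p xs)
... | false = count p xs

binRep : {m : ℕ} → PGame m → List Bool
binRep v = true ∷ false ∷ (toList v ++ (false ∷ true ∷ []))

-- Type representation (x_1,...,x_h) from a binary representation starting
-- with 1: a new type starts at each position i with b_i = 1, and x_t is the
-- number of players in the t-th block.
typeRepFrom : ℕ → List Bool → List ℕ
typeRepFrom k [] = k ∷ []
typeRepFrom k (true ∷ r) = k ∷ typeRepFrom 1 r
typeRepFrom k (false ∷ r) = typeRepFrom (suc k) r

typeRep : List Bool → List ℕ
typeRep [] = []
typeRep (_ ∷ r) = typeRepFrom 1 r

dropLast : List ℕ → List ℕ
dropLast [] = []
dropLast (x ∷ []) = []
dropLast (x ∷ y ∷ xs) = x ∷ dropLast (y ∷ xs)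

freeTypeRep : {m : ℕ} → PGame m → List ℕ
freeTypeRep v = dropLast (typeRep (binRep v))

numTypes : {m : ℕ} → PGame m → ℕ
numTypes v = length (typeRep (binRep v))

isOdd : ℕ → Bool
isOdd zero = false
isOdd (suc n) = not (isOdd n)

-- 1-based lookup.
nth : List ℕ → ℕ → Maybe ℕ
nth [] _ = nothing
nth (x ∷ xs) zero = nothing
nth (x ∷ xs) (suc zero) = just x
nth (x ∷ xs) (suc (suc i)) = nth xs (suc i)

pivot : {m : ℕ} → PGame m → Maybe ℕ
pivot v with isOdd (length (freeTypeRep v))
... | true = nth (freeTypeRep v) (numTypes v / 2)
... | false = nothing

hasPivot : {m : ℕ} → PGame m → ℕ → Bool
hasPivot v p with pivot v
... | just x = x ≡ᵇ p
... | nothing = false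

eqBool : Bool → Bool → Bool
eqBool true b = b
eqBool false b = not b

eqVec : {m : ℕ} → Vec Bool m → Vec Bool m → Bool
eqVec V.[] V.[] = true
eqVec (a V.∷ u) (b V.∷ w) = eqBool a b ∧ eqVec u w

-- Self twin: b_i = b_{n+1-i} for i = 3..n-2, i.e. the free bits form a palindrome.
selfTwin : {m : ℕ} → PGame m → Bool
selfTwin v = eqVec v (reverse v)

numSelfTwinWithPivot : ℕ → ℕ → ℕ
numSelfTwinWithPivot m p = count (λ v → selfTwin v ∧ hasPivot v p) (allVecs m)

{-# OPTIONS --safe #-}

-- A self twin game is a palindrome v of free bits, and its pivot is the middle gap
-- between consecutive 1s of the binary representation 1 0 v 0 1.  A palindrome of
-- length m + 2 is a w a with w a palindrome of length m.  If w contains a 1, wrapping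
-- it in a matching pair of bits changes only the two outermost gaps, so a w a has the
-- pivot of w, while 1 0^m 1 has pivot m + 1.  Hence the number N(m, p) of self twin
-- games with pivot p and some free 1 satisfies N(m + 2, p) = 2 N(m, p) + [p = m + 1],
-- so N(m, p) = 0 for m < p and N(2d + q + 2, q + 1) = 2^d; the all-zero game, with
-- pivot m + 3, is the only other one.

module Submission where

open import Defs
open import Data.Nat using (ℕ; _+_; _*_; _∸_; _^_; _≤_)
open import Data.Product using (_×_)
open import Relation.Binary.PropositionalEquality using (_≡_)

open import Data.Bool using (Bool; true; false; _∧_; _∨_; not; if_then_else_)
open import Data.Bool.Properties using (∧-identityʳ; ∧-zeroʳ; ∧-assoc; T-≡; ¬-not; not-involutive)
open import Data.Bool.ListAction using (or)
open import Data.List as L using (List; []; _∷_; _++_; map; length)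
open import Data.List.Properties using (++-assoc; ++-identityʳ; length-++)
open import Data.Maybe using (Maybe; just; nothing; maybe)
open import Data.Nat using (zero; suc; _<_; _≡ᵇ_; _/_; s≤s; z≤n)
open import Data.Nat.DivMod using (m*n/n≡m)
open import Data.Nat.Properties
  using (+-comm; +-suc; +-identityʳ; *-suc; ≡ᵇ⇒≡; ≡⇒≡ᵇ; <⇒≢; m≤m*n; m≤m+n;
         n<1+n; <-trans; m+n∸m≡n; m≤n⇒∃[o]m+o≡n; +-commutativeSemigroup;
         ≤-trans; n≤1+n; m≤n+m; m<m+n; suc-injective)
open import Algebra.Properties.CommutativeSemigroup +-commutativeSemigroup using (interchange)
open import Data.Product using (∃; ∃₂; _,_)
open import Data.Vec as V using (Vec; toList; reverse; replicate; _∷ʳ_)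
open import Data.Vec.Properties
  using (reverse-∷; reverse-involutive; reverse-reverse; toList-∷ʳ; toList-replicate)
open import Data.Nat.Tactic.RingSolver using (solve-∀)
open import Function using (_∘_; Equivalence)
open import Relation.Binary.PropositionalEquality
  using (refl; sym; trans; cong; cong₂; subst; _≢_; module ≡-Reasoning)

private variable
  A B : Set
  m : ℕ

count-++ : (p : A → Bool) (xs ys : List A) → count p (xs ++ ys) ≡ count p xs + count p ys
count-++ p [] ys = refl
count-++ p (x ∷ xs) ys with p x
... | true = cong suc (count-++ p xs ys)
... | false = count-++ p xs ys

count-map : (p : B → Bool) (g : A → B) (xs : List A) → count p (map g xs) ≡ count (p ∘ g) xs
count-map p g [] = refl
count-map p g (x ∷ xs) with p (g x)
... | true = cong suc (count-map p g xs)
... | false = count-map p g xs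

count-cong : {p q : A → Bool} → (∀ x → p x ≡ q x) → (xs : List A) → count p xs ≡ count q xs
count-cong p≗q [] = refl
count-cong {p = p} {q} p≗q (x ∷ xs) with p x | q x | p≗q x
... | true | true | refl = cong suc (count-cong p≗q xs)
... | false | false | refl = count-cong p≗q xs

count-false : (xs : List A) → count (λ _ → false) xs ≡ 0
count-false [] = refl
count-false (x ∷ xs) = count-false xs

count-split : (q p : A → Bool) (xs : List A) →
  count p xs ≡ count (λ x → q x ∧ p x) xs + count (λ x → not (q x) ∧ p x) xs
count-split q p [] = refl
count-split q p (x ∷ xs) with q x | p x
... | true | true = cong suc (count-split q p xs)
... | true | false = count-split q p xs
... | false | true = trans (cong suc (count-split q p xs)) (sym (+-suc _ _))
... | false | false = count-split q p xs

map-unique : {h : List A → List B} {g : A → B} →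
  h [] ≡ [] → (∀ x xs → h (x ∷ xs) ≡ g x ∷ h xs) → ∀ xs → h xs ≡ map g xs
map-unique h[] h∷ [] = h[]
map-unique h[] h∷ (x ∷ xs) = trans (h∷ x xs) (cong (_ ∷_) (map-unique h[] h∷ xs))

-- The two halves of allVecs (suc m) are built by a where-bound helper that cannot be
-- named; with _++_ abstracted to a rigid variable, unification recovers it from its
-- defining equations.
allVecs-suc : ∀ m → allVecs (suc m) ≡ map (true V.∷_) (allVecs m) ++ map (false V.∷_) (allVecs m)
allVecs-suc m with allVecs m | _++_ {A = Vec Bool (suc m)}
                 | map-unique {g = true V.∷_} refl (λ _ _ → refl)
                 | map-unique {g = false V.∷_} refl (λ _ _ → refl)
... | vs | _⊕_ | trues | falses = cong₂ _⊕_ (trues vs) (falses vs)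

countVecs : (m : ℕ) → (Vec Bool m → Bool) → ℕ
countVecs m p = count p (allVecs m)

countVecs-cong : ∀ m {p q : Vec Bool m → Bool} → (∀ v → p v ≡ q v) → countVecs m p ≡ countVecs m q
countVecs-cong m p≗q = count-cong p≗q (allVecs m)

countVecs-false : ∀ m → countVecs m (λ _ → false) ≡ 0
countVecs-false m = count-false (allVecs m)

countVecs-∷ : ∀ m (p : Vec Bool (suc m) → Bool) →
  countVecs (suc m) p ≡ countVecs m (p ∘ (true V.∷_)) + countVecs m (p ∘ (false V.∷_))
countVecs-∷ m p = begin
  count p (allVecs (suc m))
    ≡⟨ cong (count p) (allVecs-suc m) ⟩
  count p (map (true V.∷_) (allVecs m) ++ map (false V.∷_) (allVecs m))
    ≡⟨ count-++ p (map (true V.∷_) (allVecs m)) (map (false V.∷_) (allVecs m)) ⟩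
  count p (map (true V.∷_) (allVecs m)) + count p (map (false V.∷_) (allVecs m))
    ≡⟨ cong₂ _+_ (count-map p _ (allVecs m)) (count-map p _ (allVecs m)) ⟩
  countVecs m (p ∘ (true V.∷_)) + countVecs m (p ∘ (false V.∷_)) ∎
  where open ≡-Reasoning

countVecs-∷ʳ : ∀ m (p : Vec Bool (suc m) → Bool) →
  countVecs (suc m) p ≡ countVecs m (p ∘ (_∷ʳ true)) + countVecs m (p ∘ (_∷ʳ false))
countVecs-∷ʳ zero p = trans (countVecs-∷ zero p)
  (cong₂ _+_ (countVecs-cong zero {p = p ∘ (true V.∷_)} {q = p ∘ (_∷ʳ true)} λ { V.[] → refl })
             (countVecs-cong zero {p = p ∘ (false V.∷_)} {q = p ∘ (_∷ʳ false)} λ { V.[] → refl }))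
countVecs-∷ʳ (suc m) p = begin
  countVecs (suc (suc m)) p
    ≡⟨ countVecs-∷ (suc m) p ⟩
  countVecs (suc m) (p ∘ (true V.∷_)) + countVecs (suc m) (p ∘ (false V.∷_))
    ≡⟨ cong₂ _+_ (countVecs-∷ʳ m (p ∘ (true V.∷_))) (countVecs-∷ʳ m (p ∘ (false V.∷_))) ⟩
  (c true true + c true false) + (c false true + c false false)
    ≡⟨ interchange (c true true) (c true false) (c false true) (c false false) ⟩
  (c true true + c false true) + (c true false + c false false)
    ≡⟨ sym (cong₂ _+_ (countVecs-∷ m (p ∘ (_∷ʳ true))) (countVecs-∷ m (p ∘ (_∷ʳ false)))) ⟩
  countVecs (suc m) (p ∘ (_∷ʳ true)) + countVecs (suc m) (p ∘ (_∷ʳ false)) ∎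
  where
  open ≡-Reasoning
  c : Bool → Bool → ℕ
  c a b = countVecs m (λ w → p (a V.∷ (w ∷ʳ b)))

countVecs-∷-∷ʳ : ∀ m (p : Vec Bool (suc (suc m)) → Bool) →
  let c a b = countVecs m (λ w → p (a V.∷ (w ∷ʳ b))) in
  countVecs (suc (suc m)) p ≡ (c true true + c true false) + (c false true + c false false)
countVecs-∷-∷ʳ m p = trans (countVecs-∷ (suc m) p)
  (cong₂ _+_ (countVecs-∷ʳ m (p ∘ (true V.∷_))) (countVecs-∷ʳ m (p ∘ (false V.∷_))))

hasTrue : Vec Bool m → Bool
hasTrue v = or (toList v)

hasTrue-∷ʳ-false : (w : Vec Bool m) → hasTrue (w ∷ʳ false) ≡ hasTrue w
hasTrue-∷ʳ-false V.[] = refl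
hasTrue-∷ʳ-false (x V.∷ w) = cong (x ∨_) (hasTrue-∷ʳ-false w)

toℕ : Bool → ℕ
toℕ true = 1
toℕ false = 0

countVecs-split-hasTrue : ∀ m (p : Vec Bool m → Bool) →
  countVecs m p ≡ countVecs m (λ v → hasTrue v ∧ p v) + toℕ (p (replicate m false))
countVecs-split-hasTrue m p =
  trans (count-split hasTrue p (allVecs m)) (cong (countVecs m (λ v → hasTrue v ∧ p v) +_) (only-zeros m p))
  where
  only-zeros : ∀ m (p : Vec Bool m → Bool) →
    countVecs m (λ v → not (hasTrue v) ∧ p v) ≡ toℕ (p (replicate m false))
  only-zeros zero p with p V.[]
  ... | true = refl
  ... | false = refl
  only-zeros (suc m) p = begin
    countVecs (suc m) (λ v → not (hasTrue v) ∧ p v)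
      ≡⟨ countVecs-∷ m _ ⟩
    countVecs m (λ _ → false) + countVecs m (λ w → not (hasTrue w) ∧ p (false V.∷ w))
      ≡⟨ cong₂ _+_ (countVecs-false m) (only-zeros m (p ∘ (false V.∷_))) ⟩
    toℕ (p (replicate (suc m) false)) ∎
    where open ≡-Reasoning

reverse-∷ʳ : (x : A) (xs : Vec A m) → reverse (xs ∷ʳ x) ≡ x V.∷ reverse xs
reverse-∷ʳ x xs =
  reverse-reverse (trans (reverse-∷ x (reverse xs)) (cong (_∷ʳ x) (reverse-involutive xs)))

replicate-∷ʳ : ∀ m (x : A) → replicate m x ∷ʳ x ≡ x V.∷ replicate m x
replicate-∷ʳ zero x = refl
replicate-∷ʳ (suc m) x = cong (x V.∷_) (replicate-∷ʳ m x)

reverse-replicate : ∀ m (x : A) → reverse (replicate m x) ≡ replicate m x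
reverse-replicate zero x = refl
reverse-replicate (suc m) x = begin
  reverse (x V.∷ replicate m x) ≡⟨ reverse-∷ x (replicate m x) ⟩
  reverse (replicate m x) ∷ʳ x  ≡⟨ cong (_∷ʳ x) (reverse-replicate m x) ⟩
  replicate m x ∷ʳ x            ≡⟨ replicate-∷ʳ m x ⟩
  x V.∷ replicate m x           ∎
  where open ≡-Reasoning

eqBool-refl : (a : Bool) → eqBool a a ≡ true
eqBool-refl true = refl
eqBool-refl false = refl

eqVec-refl : (u : Vec Bool m) → eqVec u u ≡ true
eqVec-refl V.[] = refl
eqVec-refl (a V.∷ u) rewrite eqBool-refl a = eqVec-refl u

eqVec-∷ʳ : (u w : Vec Bool m) (a b : Bool) → eqVec (u ∷ʳ a) (w ∷ʳ b) ≡ eqVec u w ∧ eqBool a b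
eqVec-∷ʳ V.[] V.[] a b = ∧-identityʳ (eqBool a b)
eqVec-∷ʳ (c V.∷ u) (d V.∷ w) a b =
  trans (cong (eqBool c d ∧_) (eqVec-∷ʳ u w a b)) (sym (∧-assoc (eqBool c d) (eqVec u w) (eqBool a b)))

selfTwin-∷-∷ʳ : (a b : Bool) (w : Vec Bool m) →
  selfTwin (a V.∷ (w ∷ʳ b)) ≡ eqBool a b ∧ (selfTwin w ∧ eqBool b a)
selfTwin-∷-∷ʳ a b w = begin
  eqVec (a V.∷ (w ∷ʳ b)) (reverse (a V.∷ (w ∷ʳ b)))
    ≡⟨ cong (eqVec (a V.∷ (w ∷ʳ b))) (reverse-∷ a (w ∷ʳ b)) ⟩
  eqVec (a V.∷ (w ∷ʳ b)) (reverse (w ∷ʳ b) ∷ʳ a)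
    ≡⟨ cong (λ u → eqVec (a V.∷ (w ∷ʳ b)) (u ∷ʳ a)) (reverse-∷ʳ b w) ⟩
  eqBool a b ∧ eqVec (w ∷ʳ b) (reverse w ∷ʳ a)
    ≡⟨ cong (eqBool a b ∧_) (eqVec-∷ʳ w (reverse w) b a) ⟩
  eqBool a b ∧ (selfTwin w ∧ eqBool b a) ∎
  where open ≡-Reasoning

selfTwin-∷-∷ʳ-same : (a : Bool) (w : Vec Bool m) → selfTwin (a V.∷ (w ∷ʳ a)) ≡ selfTwin w
selfTwin-∷-∷ʳ-same a w rewrite selfTwin-∷-∷ʳ a a w | eqBool-refl a = ∧-identityʳ (selfTwin w)

selfTwin-replicate : ∀ m (x : Bool) → selfTwin (replicate m x) ≡ true
selfTwin-replicate m x =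
  trans (cong (eqVec (replicate m x)) (reverse-replicate m x)) (eqVec-refl (replicate m x))

typeRepFrom-++-true : ∀ k bs r → typeRepFrom k (bs ++ true ∷ r) ≡ typeRepFrom k bs ++ typeRepFrom 1 r
typeRepFrom-++-true k [] r = refl
typeRepFrom-++-true k (true ∷ bs) r = cong (k ∷_) (typeRepFrom-++-true 1 bs r)
typeRepFrom-++-true k (false ∷ bs) r = typeRepFrom-++-true (suc k) bs r

typeRepFrom-replicate : ∀ k l r → typeRepFrom k (L.replicate l false ++ r) ≡ typeRepFrom (l + k) r
typeRepFrom-replicate k zero r = refl
typeRepFrom-replicate k (suc l) r =
  trans (typeRepFrom-replicate (suc k) l r) (cong (λ j → typeRepFrom j r) (+-suc l k))

typeRepFrom-trailing : ∀ k bs →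
  ∃ λ ys → ∀ l → ∃ λ y → typeRepFrom k (bs ++ L.replicate l false) ≡ ys L.∷ʳ y
typeRepFrom-trailing k [] = [] , λ l → l + k ,
  trans (cong (typeRepFrom k) (sym (++-identityʳ (L.replicate l false)))) (typeRepFrom-replicate k l [])
typeRepFrom-trailing k (false ∷ bs) = typeRepFrom-trailing (suc k) bs
typeRepFrom-trailing k (true ∷ bs) with typeRepFrom-trailing 1 bs
... | ys , shape = k ∷ ys , λ l → let y , eq = shape l in y , cong (k ∷_) eq

typeRepFrom-interior : ∀ bs → or bs ≡ true →
  ∃ λ ys → ∀ k l → ∃₂ λ x y → typeRepFrom k (bs ++ L.replicate l false) ≡ x ∷ (ys L.∷ʳ y)
typeRepFrom-interior (false ∷ bs) has1 with typeRepFrom-interior bs has1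
... | ys , shape = ys , λ k l → shape (suc k) l
typeRepFrom-interior (true ∷ bs) _ with typeRepFrom-trailing 1 bs
... | ys , shape = ys , λ k l → let y , eq = shape l in k , y , cong (k ∷_) eq

isOdd⇒≡1+j*2 : ∀ n → isOdd n ≡ true → ∃ λ j → n ≡ suc (j * 2)
isOdd⇒≡1+j*2 (suc zero) _ = 0 , refl
isOdd⇒≡1+j*2 (suc (suc n)) odd
  with j , n≡ ← isOdd⇒≡1+j*2 n (trans (sym (not-involutive (isOdd n))) odd) = suc j , cong (suc ∘ suc) n≡

nth-++ : ∀ xs zs i → i < length xs → nth (xs ++ zs) (suc i) ≡ nth xs (suc i)
nth-++ (x ∷ xs) zs zero _ = refl
nth-++ (x ∷ xs) zs (suc i) (s≤s i<n) = nth-++ xs zs i i<n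

middle : List ℕ → Maybe ℕ
middle xs = if isOdd (length xs) then nth xs (suc (length xs) / 2) else nothing

middle-∷-∷ʳ : ∀ x ys y → middle (x ∷ (ys L.∷ʳ y)) ≡ middle ys
middle-∷-∷ʳ x ys y rewrite length-++ ys {y ∷ []} | +-comm (length ys) 1
  with isOdd (length ys) in odd
... | false = refl
... | true with j , n≡ ← isOdd⇒≡1+j*2 (length ys) odd = begin
  nth (x ∷ (ys L.∷ʳ y)) (suc (suc (suc (length ys))) / 2)
    ≡⟨ cong (λ n → nth (x ∷ (ys L.∷ʳ y)) (suc (suc (suc n)) / 2)) n≡ ⟩
  nth (x ∷ (ys L.∷ʳ y)) (suc (suc j) * 2 / 2)
    ≡⟨ cong (nth (x ∷ (ys L.∷ʳ y))) (m*n/n≡m (suc (suc j)) 2) ⟩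
  nth (ys L.∷ʳ y) (suc j)
    ≡⟨ nth-++ ys (y ∷ []) j (subst (j <_) (sym n≡) (s≤s (m≤m*n j 2))) ⟩
  nth ys (suc j)
    ≡⟨ cong (nth ys) (sym (m*n/n≡m (suc j) 2)) ⟩
  nth ys (suc j * 2 / 2)
    ≡⟨ cong (λ n → nth ys (suc n / 2)) (sym n≡) ⟩
  nth ys (suc (length ys) / 2) ∎
  where open ≡-Reasoning

middle-typeRepFrom : ∀ bs → or bs ≡ true → ∀ k l k′ l′ →
  middle (typeRepFrom k (bs ++ L.replicate l false)) ≡ middle (typeRepFrom k′ (bs ++ L.replicate l′ false))
middle-typeRepFrom bs has1 k l k′ l′ with ys , shape ← typeRepFrom-interior bs has1
  with x , y , eq ← shape k l | x′ , y′ , eq′ ← shape k′ l′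
  rewrite eq | eq′ = trans (middle-∷-∷ʳ x ys y) (sym (middle-∷-∷ʳ x′ ys y′))

dropLast-∷ʳ : ∀ xs (x : ℕ) → dropLast (xs L.∷ʳ x) ≡ xs
dropLast-∷ʳ [] x = refl
dropLast-∷ʳ (y ∷ []) x = refl
dropLast-∷ʳ (y ∷ z ∷ xs) x = cong (y ∷_) (dropLast-∷ʳ (z ∷ xs) x)

typeRep-binRep : (v : Vec Bool m) → typeRep (binRep v) ≡ typeRepFrom 2 (toList v L.∷ʳ false) L.∷ʳ 1
typeRep-binRep v = trans (cong (typeRepFrom 2) (sym (++-assoc (toList v) (false ∷ []) (true ∷ []))))
                         (typeRepFrom-++-true 2 (toList v L.∷ʳ false) [])

freeTypeRep-≡ : (v : Vec Bool m) → freeTypeRep v ≡ typeRepFrom 2 (toList v L.∷ʳ false)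
freeTypeRep-≡ v = trans (cong dropLast (typeRep-binRep v)) (dropLast-∷ʳ _ 1)

numTypes-≡ : (v : Vec Bool m) → numTypes v ≡ suc (length (freeTypeRep v))
numTypes-≡ v = begin
  length (typeRep (binRep v))         ≡⟨ cong length (typeRep-binRep v) ⟩
  length (gaps L.∷ʳ 1)                ≡⟨ length-++ gaps ⟩
  length gaps + 1                     ≡⟨ +-comm (length gaps) 1 ⟩
  suc (length gaps)                   ≡⟨ cong (suc ∘ length) (freeTypeRep-≡ v) ⟨
  suc (length (freeTypeRep v))        ∎
  where
  open ≡-Reasoning
  gaps : List ℕ
  gaps = typeRepFrom 2 (toList v L.∷ʳ false)

pivot≡middle : (v : Vec Bool m) → pivot v ≡ middle (typeRepFrom 2 (toList v L.∷ʳ false))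
pivot≡middle v = trans pivot≡middle-freeTypeRep (cong middle (freeTypeRep-≡ v))
  where
  pivot≡middle-freeTypeRep : pivot v ≡ middle (freeTypeRep v)
  pivot≡middle-freeTypeRep with isOdd (length (freeTypeRep v))
  ... | true = cong (λ h → nth (freeTypeRep v) (h / 2)) (numTypes-≡ v)
  ... | false = refl

pivot-true-∷-∷ʳ : (w : Vec Bool m) → pivot (true V.∷ (w ∷ʳ true)) ≡ middle (typeRepFrom 1 (toList w))
pivot-true-∷-∷ʳ w = begin
  pivot (true V.∷ (w ∷ʳ true))
    ≡⟨ pivot≡middle (true V.∷ (w ∷ʳ true)) ⟩
  middle (2 ∷ typeRepFrom 1 (toList (w ∷ʳ true) L.∷ʳ false))
    ≡⟨ cong (λ bs → middle (2 ∷ typeRepFrom 1 (bs L.∷ʳ false))) (toList-∷ʳ true w) ⟩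
  middle (2 ∷ typeRepFrom 1 ((toList w L.∷ʳ true) L.∷ʳ false))
    ≡⟨ cong (λ bs → middle (2 ∷ typeRepFrom 1 bs)) (++-assoc (toList w) (true ∷ []) (false ∷ [])) ⟩
  middle (2 ∷ typeRepFrom 1 (toList w ++ true ∷ false ∷ []))
    ≡⟨ cong (middle ∘ (2 ∷_)) (typeRepFrom-++-true 1 (toList w) (false ∷ [])) ⟩
  middle (2 ∷ (typeRepFrom 1 (toList w) L.∷ʳ 2))
    ≡⟨ middle-∷-∷ʳ 2 (typeRepFrom 1 (toList w)) 2 ⟩
  middle (typeRepFrom 1 (toList w)) ∎
  where open ≡-Reasoning

pivot-∷-∷ʳ : (a : Bool) (w : Vec Bool m) → hasTrue w ≡ true → pivot (a V.∷ (w ∷ʳ a)) ≡ pivot w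
pivot-∷-∷ʳ true w has1 = begin
  pivot (true V.∷ (w ∷ʳ true))
    ≡⟨ pivot-true-∷-∷ʳ w ⟩
  middle (typeRepFrom 1 (toList w))
    ≡⟨ cong (middle ∘ typeRepFrom 1) (++-identityʳ (toList w)) ⟨
  middle (typeRepFrom 1 (toList w ++ L.replicate 0 false))
    ≡⟨ middle-typeRepFrom (toList w) has1 1 0 2 1 ⟩
  middle (typeRepFrom 2 (toList w ++ L.replicate 1 false))
    ≡⟨ pivot≡middle w ⟨
  pivot w ∎
  where open ≡-Reasoning
pivot-∷-∷ʳ false w has1 = begin
  pivot (false V.∷ (w ∷ʳ false))
    ≡⟨ pivot≡middle (false V.∷ (w ∷ʳ false)) ⟩
  middle (typeRepFrom 3 (toList (w ∷ʳ false) L.∷ʳ false))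
    ≡⟨ cong (λ bs → middle (typeRepFrom 3 (bs L.∷ʳ false))) (toList-∷ʳ false w) ⟩
  middle (typeRepFrom 3 ((toList w L.∷ʳ false) L.∷ʳ false))
    ≡⟨ cong (middle ∘ typeRepFrom 3) (++-assoc (toList w) (false ∷ []) (false ∷ [])) ⟩
  middle (typeRepFrom 3 (toList w ++ L.replicate 2 false))
    ≡⟨ middle-typeRepFrom (toList w) has1 3 2 2 1 ⟩
  middle (typeRepFrom 2 (toList w ++ L.replicate 1 false))
    ≡⟨ pivot≡middle w ⟨
  pivot w ∎
  where open ≡-Reasoning

pivot-replicate : ∀ m → pivot (replicate m false) ≡ just (m + 3)
pivot-replicate m = begin
  pivot (replicate m false)
    ≡⟨ pivot≡middle (replicate m false) ⟩
  middle (typeRepFrom 2 (toList (replicate m false) L.∷ʳ false))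
    ≡⟨ cong (λ bs → middle (typeRepFrom 2 (bs L.∷ʳ false))) (toList-replicate m false) ⟩
  middle (typeRepFrom 2 (L.replicate m false L.∷ʳ false))
    ≡⟨ cong middle (typeRepFrom-replicate 2 m (false ∷ [])) ⟩
  just (suc (m + 2))
    ≡⟨ cong just (+-suc m 2) ⟨
  just (m + 3) ∎
  where open ≡-Reasoning

pivot-true-replicate-true : ∀ m → pivot (true V.∷ (replicate m false ∷ʳ true)) ≡ just (suc m)
pivot-true-replicate-true m = begin
  pivot (true V.∷ (replicate m false ∷ʳ true))
    ≡⟨ pivot-true-∷-∷ʳ (replicate m false) ⟩
  middle (typeRepFrom 1 (toList (replicate m false)))
    ≡⟨ cong (middle ∘ typeRepFrom 1) (toList-replicate m false) ⟩
  middle (typeRepFrom 1 (L.replicate m false))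
    ≡⟨ cong (middle ∘ typeRepFrom 1) (++-identityʳ (L.replicate m false)) ⟨
  middle (typeRepFrom 1 (L.replicate m false ++ []))
    ≡⟨ cong middle (typeRepFrom-replicate 1 m []) ⟩
  just (m + 1)
    ≡⟨ cong just (+-comm m 1) ⟩
  just (suc m) ∎
  where open ≡-Reasoning

hasPivot≡maybe : (v : Vec Bool m) (p : ℕ) → hasPivot v p ≡ maybe (_≡ᵇ p) false (pivot v)
hasPivot≡maybe v p with pivot v
... | just x = refl
... | nothing = refl

selfTwinWithPivot : ℕ → Vec Bool m → Bool
selfTwinWithPivot p v = selfTwin v ∧ hasPivot v p

numNonzeroSelfTwinWithPivot : ℕ → ℕ → ℕ
numNonzeroSelfTwinWithPivot m p = countVecs m (λ v → hasTrue v ∧ selfTwinWithPivot p v)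

selfTwinWithPivot-replicate : ∀ m p → selfTwinWithPivot p (replicate m false) ≡ (m + 3 ≡ᵇ p)
selfTwinWithPivot-replicate m p = cong₂ _∧_ (selfTwin-replicate m false)
  (trans (hasPivot≡maybe (replicate m false) p) (cong (maybe (_≡ᵇ p) false) (pivot-replicate m)))

selfTwinWithPivot-true-replicate-true : ∀ m p →
  selfTwinWithPivot p (true V.∷ (replicate m false ∷ʳ true)) ≡ (suc m ≡ᵇ p)
selfTwinWithPivot-true-replicate-true m p =
  cong₂ _∧_ (trans (selfTwin-∷-∷ʳ-same true (replicate m false)) (selfTwin-replicate m false))
    (trans (hasPivot≡maybe (true V.∷ (replicate m false ∷ʳ true)) p)
           (cong (maybe (_≡ᵇ p) false) (pivot-true-replicate-true m)))

hasTrue∧selfTwinWithPivot-∷-∷ʳ : (p : ℕ) (a : Bool) (w : Vec Bool m) →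
  hasTrue w ∧ selfTwinWithPivot p (a V.∷ (w ∷ʳ a)) ≡ hasTrue w ∧ selfTwinWithPivot p w
hasTrue∧selfTwinWithPivot-∷-∷ʳ p a w with hasTrue w in has1
... | false = refl
... | true = cong₂ _∧_ (selfTwin-∷-∷ʳ-same a w) (begin
  hasPivot (a V.∷ (w ∷ʳ a)) p                    ≡⟨ hasPivot≡maybe (a V.∷ (w ∷ʳ a)) p ⟩
  maybe (_≡ᵇ p) false (pivot (a V.∷ (w ∷ʳ a)))   ≡⟨ cong (maybe (_≡ᵇ p) false) (pivot-∷-∷ʳ a w has1) ⟩
  maybe (_≡ᵇ p) false (pivot w)                  ≡⟨ hasPivot≡maybe w p ⟨
  hasPivot w p                                   ∎)
  where open ≡-Reasoning

numSelfTwinWithPivot-split : ∀ m p →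
  numSelfTwinWithPivot m p ≡ numNonzeroSelfTwinWithPivot m p + toℕ (m + 3 ≡ᵇ p)
numSelfTwinWithPivot-split m p = trans (countVecs-split-hasTrue m (selfTwinWithPivot p))
  (cong (λ b → numNonzeroSelfTwinWithPivot m p + toℕ b) (selfTwinWithPivot-replicate m p))

numNonzeroSelfTwinWithPivot-suc-suc : ∀ m p →
  numNonzeroSelfTwinWithPivot (suc (suc m)) p ≡ 2 * numNonzeroSelfTwinWithPivot m p + toℕ (suc m ≡ᵇ p)
numNonzeroSelfTwinWithPivot-suc-suc m p = begin
  numNonzeroSelfTwinWithPivot (suc (suc m)) p
    ≡⟨ countVecs-∷-∷ʳ m (λ v → hasTrue v ∧ selfTwinWithPivot p v) ⟩
  (c true true + c true false) + (c false true + c false false)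
    ≡⟨ cong₂ _+_ (cong₂ _+_ ends-true mismatched-true) (cong₂ _+_ mismatched-false ends-false) ⟩
  (N + toℕ (suc m ≡ᵇ p) + 0) + (0 + N)
    ≡⟨ arithmetic N (toℕ (suc m ≡ᵇ p)) ⟩
  2 * N + toℕ (suc m ≡ᵇ p) ∎
  where
  open ≡-Reasoning
  N : ℕ
  N = numNonzeroSelfTwinWithPivot m p
  c : Bool → Bool → ℕ
  c a b = countVecs m (λ w → hasTrue (a V.∷ (w ∷ʳ b)) ∧ selfTwinWithPivot p (a V.∷ (w ∷ʳ b)))
  arithmetic : ∀ n t → (n + t + 0) + (0 + n) ≡ 2 * n + t
  arithmetic = solve-∀
  ends-true : c true true ≡ N + toℕ (suc m ≡ᵇ p)
  ends-true = begin
    countVecs m (λ w → selfTwinWithPivot p (true V.∷ (w ∷ʳ true)))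
      ≡⟨ countVecs-split-hasTrue m _ ⟩
    countVecs m (λ w → hasTrue w ∧ selfTwinWithPivot p (true V.∷ (w ∷ʳ true)))
      + toℕ (selfTwinWithPivot p (true V.∷ (replicate m false ∷ʳ true)))
      ≡⟨ cong₂ _+_ (countVecs-cong m (hasTrue∧selfTwinWithPivot-∷-∷ʳ p true))
                   (cong toℕ (selfTwinWithPivot-true-replicate-true m p)) ⟩
    N + toℕ (suc m ≡ᵇ p) ∎
  ends-false : c false false ≡ N
  ends-false = countVecs-cong m λ w →
    trans (cong (_∧ selfTwinWithPivot p (false V.∷ (w ∷ʳ false))) (hasTrue-∷ʳ-false w))
          (hasTrue∧selfTwinWithPivot-∷-∷ʳ p false w)
  mismatched-true : c true false ≡ 0
  mismatched-true = trans
    (countVecs-cong m λ w → cong (_∧ hasPivot (true V.∷ (w ∷ʳ false)) p) (selfTwin-∷-∷ʳ true false w))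
    (countVecs-false m)
  mismatched-false : c false true ≡ 0
  mismatched-false = trans
    (countVecs-cong m λ w → trans
      (cong (λ b → hasTrue (false V.∷ (w ∷ʳ true)) ∧ (b ∧ hasPivot (false V.∷ (w ∷ʳ true)) p))
            (selfTwin-∷-∷ʳ false true w))
      (∧-zeroʳ (hasTrue (false V.∷ (w ∷ʳ true)))))
    (countVecs-false m)

≡ᵇ-refl : ∀ n → (n ≡ᵇ n) ≡ true
≡ᵇ-refl n = Equivalence.to T-≡ (≡⇒≡ᵇ n n refl)

≢⇒≡ᵇ≡false : ∀ {m n} → m ≢ n → (m ≡ᵇ n) ≡ false
≢⇒≡ᵇ≡false {m} {n} m≢n = ¬-not (m≢n ∘ ≡ᵇ⇒≡ m n ∘ Equivalence.from T-≡)

numNonzeroSelfTwinWithPivot-< : ∀ m p → m < p → numNonzeroSelfTwinWithPivot m p ≡ 0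
numNonzeroSelfTwinWithPivot-< zero p _ = refl
numNonzeroSelfTwinWithPivot-< (suc zero) p _ = refl
numNonzeroSelfTwinWithPivot-< (suc (suc m)) p m+2<p = begin
  numNonzeroSelfTwinWithPivot (suc (suc m)) p
    ≡⟨ numNonzeroSelfTwinWithPivot-suc-suc m p ⟩
  2 * numNonzeroSelfTwinWithPivot m p + toℕ (suc m ≡ᵇ p)
    ≡⟨ cong₂ (λ n b → 2 * n + toℕ b) (numNonzeroSelfTwinWithPivot-< m p m<p)
                                    (≢⇒≡ᵇ≡false (<⇒≢ m+1<p)) ⟩
  0 ∎
  where
  open ≡-Reasoning
  m+1<p : suc m < p
  m+1<p = <-trans (n<1+n (suc m)) m+2<p
  m<p : m < p
  m<p = <-trans (n<1+n m) m+1<p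

numNonzeroSelfTwinWithPivot-value : ∀ q d →
  numNonzeroSelfTwinWithPivot (2 * d + suc (suc q)) (suc q) ≡ 2 ^ d
numNonzeroSelfTwinWithPivot-value q zero = begin
  numNonzeroSelfTwinWithPivot (suc (suc q)) (suc q)
    ≡⟨ numNonzeroSelfTwinWithPivot-suc-suc q (suc q) ⟩
  2 * numNonzeroSelfTwinWithPivot q (suc q) + toℕ (suc q ≡ᵇ suc q)
    ≡⟨ cong₂ (λ n b → 2 * n + toℕ b) (numNonzeroSelfTwinWithPivot-< q (suc q) (n<1+n q))
                                    (≡ᵇ-refl (suc q)) ⟩
  1 ∎
  where open ≡-Reasoning
numNonzeroSelfTwinWithPivot-value q (suc d) = begin
  numNonzeroSelfTwinWithPivot (2 * suc d + suc (suc q)) (suc q)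
    ≡⟨ cong (λ n → numNonzeroSelfTwinWithPivot (n + suc (suc q)) (suc q)) (*-suc 2 d) ⟩
  numNonzeroSelfTwinWithPivot (suc (suc len)) (suc q)
    ≡⟨ numNonzeroSelfTwinWithPivot-suc-suc len (suc q) ⟩
  2 * numNonzeroSelfTwinWithPivot len (suc q) + toℕ (suc len ≡ᵇ suc q)
    ≡⟨ cong₂ (λ n b → 2 * n + toℕ b) (numNonzeroSelfTwinWithPivot-value q d)
                                    (≢⇒≡ᵇ≡false (<⇒≢ q<len ∘ sym ∘ suc-injective)) ⟩
  2 * 2 ^ d + 0
    ≡⟨ +-identityʳ (2 ^ suc d) ⟩
  2 ^ suc d ∎
  where
  open ≡-Reasoning
  len : ℕ
  len = 2 * d + suc (suc q)
  q<len : q < len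
  q<len = ≤-trans (n≤1+n (suc q)) (m≤n+m (suc (suc q)) (2 * d))

numSelfTwinWithPivot-top : ∀ m → numSelfTwinWithPivot m (m + 3) ≡ 1
numSelfTwinWithPivot-top m = begin
  numSelfTwinWithPivot m (m + 3)
    ≡⟨ numSelfTwinWithPivot-split m (m + 3) ⟩
  numNonzeroSelfTwinWithPivot m (m + 3) + toℕ (m + 3 ≡ᵇ m + 3)
    ≡⟨ cong₂ (λ n b → n + toℕ b) (numNonzeroSelfTwinWithPivot-< m (m + 3) (m<m+n m (s≤s z≤n)))
                                (≡ᵇ-refl (m + 3)) ⟩
  1 ∎
  where open ≡-Reasoning

numSelfTwinWithPivot-value : ∀ q d → numSelfTwinWithPivot (2 * d + suc (suc q)) (suc q) ≡ 2 ^ d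
numSelfTwinWithPivot-value q d = begin
  numSelfTwinWithPivot len (suc q)
    ≡⟨ numSelfTwinWithPivot-split len (suc q) ⟩
  numNonzeroSelfTwinWithPivot len (suc q) + toℕ (len + 3 ≡ᵇ suc q)
    ≡⟨ cong₂ (λ n b → n + toℕ b) (numNonzeroSelfTwinWithPivot-value q d)
                                (≢⇒≡ᵇ≡false (<⇒≢ q+1<len+3 ∘ sym)) ⟩
  2 ^ d + 0
    ≡⟨ +-identityʳ (2 ^ d) ⟩
  2 ^ d ∎
  where
  open ≡-Reasoning
  len : ℕ
  len = 2 * d + suc (suc q)
  q+1<len+3 : suc q < len + 3
  q+1<len+3 = ≤-trans (m≤n+m (suc (suc q)) (2 * d)) (m≤m+n len 3)

numSelfTwinWithPivot-odd : ∀ k c → 1 ≤ c → c ≤ k →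
  numSelfTwinWithPivot (2 * k) (2 * c ∸ 1) ≡ 2 ^ (k ∸ c)
numSelfTwinWithPivot-odd k (suc c) _ c≤k with d , refl ← m≤n⇒∃[o]m+o≡n c≤k = begin
  numSelfTwinWithPivot (2 * (suc c + d)) (2 * suc c ∸ 1)
    ≡⟨ cong₂ numSelfTwinWithPivot (double-+ c d) (cong (_∸ 1) (*-suc 2 c)) ⟩
  numSelfTwinWithPivot (2 * d + suc (suc (2 * c))) (suc (2 * c))
    ≡⟨ numSelfTwinWithPivot-value (2 * c) d ⟩
  2 ^ d
    ≡⟨ cong (2 ^_) (m+n∸m≡n (suc c) d) ⟨
  2 ^ (suc c + d ∸ suc c) ∎
  where
  open ≡-Reasoning
  double-+ : ∀ c d → 2 * (suc c + d) ≡ 2 * d + suc (suc (2 * c))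
  double-+ = solve-∀

mainTheorem13 : (k : ℕ) →
    ((c : ℕ) → 1 ≤ c → c ≤ k →
      numSelfTwinWithPivot (2 * k) (2 * c ∸ 1) ≡ 2 ^ (k ∸ c))
    × numSelfTwinWithPivot (2 * k) (2 * k + 3) ≡ 1
mainTheorem13 k = numSelfTwinWithPivot-odd k , numSelfTwinWithPivot-top (2 * k)
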